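{- The functor $\tilde H_0:\mathsf{CNOT}\to\mathsf{ParIso}(\mathsf{CTor}_2)^*$ is full.
   Context: $\mathsf{CNOT}$ is the strict symmetric monoidal category with objects the natural numbers ($n\otimes m=n+m$) generated by $\mathsf{cnot}:2\to2$, $|1\rangle:0\to1$, $\langle1|:1\to0$ (and symmetry $\sigma$) modulo the identities below (diagrammatic composition; $C_{i\to j}$ the cnot with control wire $i$, target wire $j$): $C_{1\to2}C_{2\to1}C_{1\to2}=\sigma$; $C_{1\to2}C_{1\to2}=1_2$; $C_{2\to1}C_{2\to3}=C_{2\to3}C_{2\to1}$; $(|1\rangle\otimes1)C_{1\to2}=(|1\rangle\otimes1)C_{1\to2}(\langle1|\otimes1)(|1\rangle\otimes1)$ and $C_{1\to2}(\langle1|\otimes1)=(\langle1|\otimes1)(|1\rangle\otimes1)C_{1\to2}(\langle1|\otimes1)$; $C_{1\to2}C_{3\to2}=C_{3\to2}C_{1\to2}$; $|1\rangle\langle1|=1_0$; $(|1\rangle\otimes|1\rangle\otimes1)C_{1\to2}C_{2\to3}(\langle1|\otimes1_2)=(|1\rangle\otimes|1\rangle\otimes1)C_{1\to2}(\langle1|\otimes1_2)$ and $(|1\rangle\otimes1_2)C_{2\to3}C_{1\to2}(\langle1|\otimes\langle1|\otimes1)=(|1\rangle\otimes1_2)C_{1\to2}(\langle1|\otimes\langle1|\otimes1)$; $C_{1\to2}C_{2\to3}C_{1\to2}=C_{2\to3}C_{1\to3}$; $(|1\rangle\otimes|1\rangle\otimes1)C_{1\to2}(\langle1|\otimes\langle1|\otimes1)=(|1\rangle\otimes|1\rangle\otimes\langle1|)C_{1\to2}(\langle1|\otimes\langle1|\otimes|1\rangle)$.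 $\mathsf{CTor}_2$: finitely generated commutative torsors of characteristic 2 (ternary $a\times_b c$ with para-associativity, $a\times_b b=b\times_b a=a$, $a\times_b c=c\times_b a$, $a\times_b a=b$) with homomorphisms. $\mathsf{ParIso}(\mathsf{CTor}_2)^*$: nonempty such torsors with partial isomorphisms (spans $A\xleftarrow{m}A'\xrightarrow{f}B$, $m$ monic, modulo iso, having partial inverses). $\tilde H_0$: the monoidal functor with $\tilde H_0(n)=\mathbb{Z}_2^n$ ($a\times_b c=a\oplus b\oplus c$), $\mathsf{cnot}\mapsto((x,y)\mapsto(x,x\oplus y))$, $\sigma\mapsto$ swap, $|1\rangle\mapsto$ the point $1$, $\langle1|\mapsto$ the partial map $\mathbb{Z}_2\to\mathbb{Z}_2^0$ defined only at $1$. -}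

module Defs where

open import Data.Nat using (ℕ; _+_)
open import Data.Bool using (Bool; true; false; _xor_)
open import Data.Vec using (Vec; []; _∷_; _++_; splitAt; zipWith)
open import Data.Maybe using (Maybe; just; nothing; _>>=_)
open import Data.List using (List)
open import Data.List.Membership.Propositional using (_∈_)
open import Data.Product using (Σ; ∃; _×_; _,_)
open import Function.Bundles using (_⇔_)
open import Relation.Binary.PropositionalEquality using (_≡_)

-- Morphisms n → m of CNOT are these terms (generated by cnot, |1⟩, ⟨1|,
-- the symmetry σ = σ_{1,1}, identities, composition and tensor) taken
-- modulo the listed identities.  Fullness only concerns the image of the
-- functor, which is the same for terms and for their equivalence
-- classes, so the quotient is not needed for the statement.

data Circ : ℕ → ℕ → Set where
  idc  : ∀ n → Circ n n
  _⨾_  : ∀ {a b c} → Circ a b → Circ b c → Circ a c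
  _⊗_  : ∀ {a b c d} → Circ a b → Circ c d → Circ (a + c) (b + d)
  cnot : Circ 2 2
  σ    : Circ 2 2
  ket1 : Circ 0 1
  bra1 : Circ 1 0

-- The functor H̃₀ on morphisms, as partial maps Z₂ⁿ ⇀ Z₂ᵐ
-- (Kleisli composition of Maybe = composition of partial maps).

Z2^ : ℕ → Set
Z2^ n = Vec Bool n

tern : ∀ {n} → Z2^ n → Z2^ n → Z2^ n → Z2^ n
tern a b c = zipWith _xor_ (zipWith _xor_ a b) c

⟦_⟧ : ∀ {n m} → Circ n m → Z2^ n → Maybe (Z2^ m)
⟦ idc n ⟧ x = just x
⟦ f ⨾ g ⟧ x = ⟦ f ⟧ x >>= ⟦ g ⟧
⟦ _⊗_ {a} f g ⟧ x with splitAt a x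
... | (x₁ , x₂ , _) = ⟦ f ⟧ x₁ >>= λ y₁ → ⟦ g ⟧ x₂ >>= λ y₂ → just (y₁ ++ y₂)
⟦ cnot ⟧ (x ∷ y ∷ []) = just (x ∷ (x xor y) ∷ [])
⟦ σ ⟧ (x ∷ y ∷ []) = just (y ∷ x ∷ [])
⟦ ket1 ⟧ [] = just (true ∷ [])
⟦ bra1 ⟧ (true ∷ []) = just []
⟦ bra1 ⟧ (false ∷ []) = nothing

data Generated {C : Set} (t : C → C → C → C) (gens : List C) : C → Set where
  gen  : ∀ {x} → x ∈ gens → Generated t gens x
  gtern : ∀ {a b c} → Generated t gens a → Generated t gens b →
         Generated t gens c → Generated t gens (t a b c)

record CTor2 : Set₁ where
  field
    Carrier : Set
    _×[_]_  : Carrier → Carrier → Carrier → Carrier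
    para₁   : ∀ a b c d e → (a ×[ b ] c) ×[ d ] e ≡ a ×[ b ] (c ×[ d ] e)
    para₂   : ∀ a b c d e → a ×[ b ] (c ×[ d ] e) ≡ a ×[ d ×[ c ] b ] e
    unitʳ   : ∀ a b → a ×[ b ] b ≡ a
    unitˡ   : ∀ a b → b ×[ b ] a ≡ a
    comm    : ∀ a b c → a ×[ b ] c ≡ c ×[ b ] a
    char2   : ∀ a b → a ×[ b ] a ≡ b
    finGen  : Σ (List Carrier) λ gens → ∀ x → Generated _×[_]_ gens x

open CTor2

IsHom : (A B : CTor2) → (Carrier A → Carrier B) → Set
IsHom A B f = ∀ a b c → f (_×[_]_ A a b c) ≡ _×[_]_ B (f a) (f b) (f c)

IsHomZ : (A : CTor2) {n : ℕ} → (Carrier A → Z2^ n) → Set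
IsHomZ A f = ∀ a b c → f (_×[_]_ A a b c) ≡ tern (f a) (f b) (f c)

IsMonic : (A : CTor2) {n : ℕ} → (Carrier A → Z2^ n) → Set₁
IsMonic A m = ∀ (T : CTor2) (g h : Carrier T → Carrier A) →
  IsHom T A g → IsHom T A h → (∀ t → m (g t) ≡ m (h t)) → ∀ t → g t ≡ h t

-- Morphisms of ParIso(CTor₂) between Z₂ⁿ and Z₂ᵐ: spans Z₂ⁿ ← A' → Z₂ᵐ
-- with monic left leg, considered up to iso of spans.

record Span (n m : ℕ) : Set₁ where
  field
    apex      : CTor2
    left      : Carrier apex → Z2^ n
    right     : Carrier apex → Z2^ m
    leftHom   : IsHomZ apex left
    rightHom  : IsHomZ apex right
    leftMonic : IsMonic apex left

open Span

-- the relation a span denotes (spans with monic left leg are determined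
-- up to iso by it)
Rel : ∀ {n m} → Span n m → Z2^ n → Z2^ m → Set
Rel S x y = ∃ λ a → left S a ≡ x × right S a ≡ y

-- S ; T  =  r(S)  as spans (up to iso), via their relations
CompIsRestr : ∀ {n m} → Span n m → Span m n → Set
CompIsRestr S T = ∀ x x' →
  (∃ λ y → Rel S x y × Rel T y x') ⇔ (x ≡ x' × ∃ λ y → Rel S x y)

IsPartialIso : ∀ {n m} → Span n m → Set₁
IsPartialIso {n} {m} S = Σ (Span m n) λ T → CompIsRestr S T × CompIsRestr T S

Represents : ∀ {n m} → (Z2^ n → Maybe (Z2^ m)) → Span n m → Set
Represents p S = ∀ x y → (p x ≡ just y) ⇔ Rel S x y

module Submission where

-- The relation R = Rel S of a partial isomorphism S between Z₂ⁿ and Z₂ᵐ is closed under the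
-- torsor operation, functional (the left leg is monic) and injective (S ; T = r(S)). It is
-- decidable: the apex is finitely generated, so each of its elements is g₀ + Σᵢ Iᵢ (gᵢ - g₀) for
-- some bit vector I, and the bit vectors can be searched. Adding one coordinate at a time, R
-- extends to an affine map h : Z₂ⁿ → Z₂ᵐ with values in the range of R, and its converse extends
-- to an affine k : Z₂ᵐ → Z₂ⁿ; then R x y holds iff k (h x) = x and h x = y. The circuit adds h x
-- to fresh zero wires and then k (h x) to the input wires, using controlled nots for the columns
-- and nots for the constants, and postselects the input wires on 0. Here not is cnot with its
-- control prepared by |1⟩ and postselected by ⟨1|, |0⟩ = not |1⟩ and ⟨0| = ⟨1| not. An empty R
-- is realised through the scalar ⟨1|0⟩, which is undefined.

open import Defs
open import Level using (0ℓ)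
open import Data.Nat using (ℕ; zero; suc; _+_)
open import Data.Bool using (Bool; true; false; not; _∧_; _xor_; _≟_)
open import Data.Bool.Properties using (xor-assoc; xor-comm; xor-identityˡ; xor-identityʳ; xor-same)
open import Data.Vec using (Vec; []; _∷_; _++_; splitAt; zipWith; replicate)
open import Data.Vec.Properties
  using (zipWith-assoc; zipWith-comm; zipWith-identityˡ; zipWith-identityʳ; ≡-dec)
open import Data.Maybe using (just; nothing; _>>=_)
open import Data.Maybe.Properties using (just-injective)
open import Data.List using (List; length) renaming ([] to []ᴸ; _∷_ to _∷ᴸ_)
open import Data.List.Relation.Unary.Any using (here; there)
open import Data.List.Membership.Propositional using (_∈_)
open import Data.Product using (Σ; ∃; ∃₂; _×_; _,_; proj₁; proj₂)
open import Data.Sum using (inj₁; inj₂)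
open import Data.Unit using (⊤; tt)
open import Data.Empty using (⊥-elim)
open import Function using (id; flip; _∘_)
open import Function.Bundles using (_⇔_; mk⇔; Equivalence)
open import Function.Properties.Equivalence using () renaming (trans to ⇔-trans; sym to ⇔-sym)
open import Algebra.Bundles using (AbelianGroup)
open import Algebra.Structures using (IsAbelianGroup)
import Algebra.Properties.AbelianGroup as AbelianGroupProperties
import Algebra.Properties.CommutativeSemigroup as CommutativeSemigroupProperties
open import Relation.Nullary using (Dec; yes; no; ¬_)
open import Relation.Nullary.Decidable using (map′; _×-dec_; _⊎-dec_)
open import Relation.Unary using (Decidable)
open import Relation.Binary.Definitions using () renaming (Decidable to Decidable₂)
open import Relation.Binary.PropositionalEquality
  using (_≡_; refl; sym; trans; cong; cong₂; subst; subst₂; module ≡-Reasoning)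
open import Relation.Binary.PropositionalEquality.Algebra using (isMagma)

open CTor2
open Span

infixl 6 _⊕_

_⊕_ : ∀ {k} → Z2^ k → Z2^ k → Z2^ k
_⊕_ = zipWith _xor_

0v : ∀ {k} → Z2^ k
0v = replicate _ false

⊕-self : ∀ {k} (x : Z2^ k) → x ⊕ x ≡ 0v
⊕-self []      = refl
⊕-self (b ∷ x) = cong₂ _∷_ (xor-same b) (⊕-self x)

⊕-isAbelianGroup : ∀ {k} → IsAbelianGroup _≡_ (_⊕_ {k}) 0v id
⊕-isAbelianGroup = record
  { isGroup = record
    { isMonoid = record
      { isSemigroup = record { isMagma = isMagma _⊕_ ; assoc = zipWith-assoc xor-assoc }
      ; identity    = zipWith-identityˡ xor-identityˡ , zipWith-identityʳ xor-identityʳ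
      }
    ; inverse = ⊕-self , ⊕-self
    ; ⁻¹-cong = cong id
    }
  ; comm = zipWith-comm xor-comm
  }

⊕-abelianGroup : ℕ → AbelianGroup 0ℓ 0ℓ
⊕-abelianGroup k = record { isAbelianGroup = ⊕-isAbelianGroup {k} }

module ⊕ {k : ℕ} where
  open AbelianGroup (⊕-abelianGroup k) public using (assoc; identityˡ; identityʳ)
  open AbelianGroupProperties (⊕-abelianGroup k) public
    using (∙-cancelʳ; \\-leftDividesʳ; //-rightDividesʳ; x∙y⁻¹≈ε⇒x≈y; x≈y⇒x∙y⁻¹≈ε)
  open CommutativeSemigroupProperties (AbelianGroup.commutativeSemigroup (⊕-abelianGroup k)) public
    using (interchange; xy∙z≈zy∙x)

tern-⊕-interchange : ∀ {k} (a b c a′ b′ c′ : Z2^ k) →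
                     tern a b c ⊕ tern a′ b′ c′ ≡ tern (a ⊕ a′) (b ⊕ b′) (c ⊕ c′)
tern-⊕-interchange a b c a′ b′ c′ =
  trans (⊕.interchange (a ⊕ b) c (a′ ⊕ b′) c′) (cong (_⊕ (c ⊕ c′)) (⊕.interchange a b a′ b′))

scale : ∀ {k} → Bool → Z2^ k → Z2^ k
scale false _ = 0v
scale true  d = d

scale-xor : ∀ {k} a b (d : Z2^ k) → scale (a xor b) d ≡ scale a d ⊕ scale b d
scale-xor false b     d = sym (⊕.identityˡ (scale b d))
scale-xor true  false d = sym (⊕.identityʳ d)
scale-xor true  true  d = sym (⊕-self d)

scale-tern : ∀ {k} a b c (d : Z2^ k) →
             scale ((a xor b) xor c) d ≡ tern (scale a d) (scale b d) (scale c d)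
scale-tern a b c d = trans (scale-xor (a xor b) c d) (cong (_⊕ scale c d) (scale-xor a b d))

infixr 5 _∷_

-- x ↦ c ⊕ Σᵢ xᵢ dᵢ, given by its columns dᵢ followed by the constant c
data Affine (m : ℕ) : ℕ → Set where
  constant : Z2^ m → Affine m 0
  _∷_      : ∀ {n} → Z2^ m → Affine m n → Affine m (suc n)

infix 7 _⟨$⟩_

_⟨$⟩_ : ∀ {n m} → Affine m n → Z2^ n → Z2^ m
constant c ⟨$⟩ []      = c
(d ∷ f)    ⟨$⟩ (b ∷ x) = scale b d ⊕ (f ⟨$⟩ x)

⟨$⟩-tern : ∀ {n m} (f : Affine m n) x y z → f ⟨$⟩ tern x y z ≡ tern (f ⟨$⟩ x) (f ⟨$⟩ y) (f ⟨$⟩ z)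
⟨$⟩-tern (constant c) [] [] [] = sym (⊕.//-rightDividesʳ c c)
⟨$⟩-tern (d ∷ f) (a ∷ x) (b ∷ y) (c ∷ z) = begin
  scale ((a xor b) xor c) d ⊕ (f ⟨$⟩ tern x y z)
    ≡⟨ cong₂ _⊕_ (scale-tern a b c d) (⟨$⟩-tern f x y z) ⟩
  tern (scale a d) (scale b d) (scale c d) ⊕ tern (f ⟨$⟩ x) (f ⟨$⟩ y) (f ⟨$⟩ z)
    ≡⟨ tern-⊕-interchange _ _ _ _ _ _ ⟩
  tern ((d ∷ f) ⟨$⟩ (a ∷ x)) ((d ∷ f) ⟨$⟩ (b ∷ y)) ((d ∷ f) ⟨$⟩ (c ∷ z))
    ∎
  where open ≡-Reasoning

⟨$⟩-zero-column : ∀ {n m} (f : Affine m n) b x → (0v ∷ f) ⟨$⟩ (b ∷ x) ≡ f ⟨$⟩ x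
⟨$⟩-zero-column f false x = ⊕.identityˡ (f ⟨$⟩ x)
⟨$⟩-zero-column f true  x = ⊕.identityˡ (f ⟨$⟩ x)

Searchable : Set → Set₁
Searchable A = ∀ {P : A → Set} → Decidable P → Dec (∃ P)

Z2^-searchable : ∀ k → Searchable (Z2^ k)
Z2^-searchable zero    P? = map′ ([] ,_) (λ { ([] , p) → p }) (P? [])
Z2^-searchable (suc k) P? =
  map′ (λ { (inj₁ (x , p)) → false ∷ x , p ; (inj₂ (x , p)) → true ∷ x , p })
       (λ { (false ∷ x , p) → inj₁ (x , p) ; (true ∷ x , p) → inj₂ (x , p) })
       (Z2^-searchable k (P? ∘ (false ∷_)) ⊎-dec Z2^-searchable k (P? ∘ (true ∷_)))

∃₂? : ∀ {n m} {R : Z2^ n → Z2^ m → Set} → Decidable₂ R → Dec (∃₂ R)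
∃₂? {n} {m} R? = Z2^-searchable n (λ x → Z2^-searchable m (R? x))

surjection-searchable : ∀ {A B : Set} (f : A → B) → (∀ b → ∃ λ a → f a ≡ b) →
                        Searchable A → Searchable B
surjection-searchable f surjective search {P} P? =
  map′ (λ (a , p) → f a , p)
       (λ (b , p) → let a , fa≡b = surjective b in a , subst P (sym fa≡b) p)
       (search (P? ∘ f))

empty-searchable : ∀ {A : Set} → ¬ A → Searchable A
empty-searchable ¬a _ = no (¬a ∘ proj₁)

⊤-torsor : CTor2
⊤-torsor = record
  { Carrier = ⊤ ; _×[_]_ = λ _ _ _ → tt
  ; para₁ = λ _ _ _ _ _ → refl ; para₂ = λ _ _ _ _ _ → refl
  ; unitʳ = λ _ _ → refl ; unitˡ = λ _ _ → refl ; comm = λ _ _ _ → refl ; char2 = λ _ _ → refl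
  ; finGen = tt ∷ᴸ []ᴸ , λ _ → gen (here refl)
  }

-- Test monicity against the two constant maps out of the one-point torsor.
monic⇒injective : ∀ {n} (A : CTor2) (ι : Carrier A → Z2^ n) → IsMonic A ι →
                  ∀ {a b} → ι a ≡ ι b → a ≡ b
monic⇒injective A ι monic {a} {b} ιa≡ιb =
  monic ⊤-torsor (λ _ → a) (λ _ → b) (λ _ _ _ → sym (unitʳ A a a)) (λ _ _ _ → sym (unitʳ A b b))
        (λ _ → ιa≡ιb) tt

ungenerated : ∀ {C : Set} {t : C → C → C → C} {a} → ¬ Generated t []ᴸ a
ungenerated (gen ())
ungenerated (gtern d _ _) = ungenerated d

module _ (A : CTor2) (g₀ : Carrier A) where
  private
    _·[_]_ = _×[_]_ A

  combination : (gs : List (Carrier A)) → Vec Bool (length gs) → Carrier A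
  combination []ᴸ        []          = g₀
  combination (g ∷ᴸ gs) (false ∷ I) = combination gs I
  combination (g ∷ᴸ gs) (true  ∷ I) = combination gs I ·[ g₀ ] g

  indicator : ∀ {g} {gs : List (Carrier A)} → g ∈ gs → Vec Bool (length gs)
  indicator (here _)     = true ∷ 0v
  indicator (there g∈gs) = false ∷ indicator g∈gs

  combination-0v : ∀ gs → combination gs 0v ≡ g₀
  combination-0v []ᴸ        = refl
  combination-0v (_ ∷ᴸ gs) = combination-0v gs

  combination-indicator : ∀ {g} gs (g∈gs : g ∈ gs) → combination gs (indicator g∈gs) ≡ g
  combination-indicator (g ∷ᴸ gs) (here refl)  =
    trans (cong (_·[ g₀ ] g) (combination-0v gs)) (unitˡ A g g₀)
  combination-indicator (_ ∷ᴸ gs) (there g∈gs) = combination-indicator gs g∈gs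

  module _ {k} (ι : Carrier A → Z2^ k) (hom : IsHomZ A ι) where

    spanned : (gs : List (Carrier A)) → Affine k (length gs)
    spanned []ᴸ        = constant (ι g₀)
    spanned (g ∷ᴸ gs) = (ι g ⊕ ι g₀) ∷ spanned gs

    ι-combination : ∀ gs I → ι (combination gs I) ≡ spanned gs ⟨$⟩ I
    ι-combination []ᴸ        []          = refl
    ι-combination (g ∷ᴸ gs) (false ∷ I) = trans (ι-combination gs I) (sym (⊕.identityˡ _))
    ι-combination (g ∷ᴸ gs) (true  ∷ I) = begin
      ι (combination gs I ·[ g₀ ] g)           ≡⟨ hom _ _ _ ⟩
      tern (ι (combination gs I)) (ι g₀) (ι g) ≡⟨ cong (λ v → tern v (ι g₀) (ι g)) (ι-combination gs I) ⟩
      tern (spanned gs ⟨$⟩ I) (ι g₀) (ι g)     ≡⟨ ⊕.xy∙z≈zy∙x _ _ _ ⟩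
      (ι g ⊕ ι g₀) ⊕ (spanned gs ⟨$⟩ I)        ∎
      where open ≡-Reasoning

    -- Closure of the image under the torsor operation is checked after ι, which turns
    -- combination into the affine map spanned gs.
    combination-surjective : (∀ {a b} → ι a ≡ ι b → a ≡ b) → ∀ gs {a} →
                             Generated (_×[_]_ A) (g₀ ∷ᴸ gs) a → ∃ λ I → combination gs I ≡ a
    combination-surjective _ gs (gen (here refl))  = 0v , combination-0v gs
    combination-surjective _ gs (gen (there g∈gs)) = indicator g∈gs , combination-indicator gs g∈gs
    combination-surjective injective gs (gtern {a} {b} {c} da db dc)
      with combination-surjective injective gs da
         | combination-surjective injective gs db
         | combination-surjective injective gs dc
    ... | I , refl | J , refl | K , refl = tern I J K , injective (begin
      ι (combination gs (tern I J K))       ≡⟨ ι-combination gs (tern I J K) ⟩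
      spanned gs ⟨$⟩ tern I J K             ≡⟨ ⟨$⟩-tern (spanned gs) I J K ⟩
      tern (spanned gs ⟨$⟩ I) (spanned gs ⟨$⟩ J) (spanned gs ⟨$⟩ K)
        ≡⟨ sym (cong₃ tern (ι-combination gs I) (ι-combination gs J) (ι-combination gs K)) ⟩
      tern (ι a) (ι b) (ι c)                 ≡⟨ sym (hom a b c) ⟩
      ι (a ·[ b ] c)                         ∎)
      where
      open ≡-Reasoning
      cong₃ : ∀ {X : Set} (f : X → X → X → X) {x x′ y y′ z z′} →
              x ≡ x′ → y ≡ y′ → z ≡ z′ → f x y z ≡ f x′ y′ z′
      cong₃ f refl refl refl = refl

carrier-searchable : ∀ {k} (A : CTor2) (ι : Carrier A → Z2^ k) → IsHomZ A ι →
                     (∀ {a b} → ι a ≡ ι b → a ≡ b) → Searchable (Carrier A)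
carrier-searchable A ι hom injective with finGen A
... | []ᴸ        , generated = empty-searchable (λ a → ungenerated (generated a))
... | g₀ ∷ᴸ gs , generated =
  surjection-searchable (combination A g₀ gs)
    (λ a → combination-surjective A g₀ ι hom injective gs (generated a)) (Z2^-searchable _)

Functional : ∀ {A B : Set} → (A → B → Set) → Set
Functional R = ∀ {x y y′} → R x y → R x y′ → y ≡ y′

TernClosed : ∀ {n m} → (Z2^ n → Z2^ m → Set) → Set
TernClosed R = ∀ {x₁ x₂ x₃ y₁ y₂ y₃} → R x₁ y₁ → R x₂ y₂ → R x₃ y₃ → R (tern x₁ x₂ x₃) (tern y₁ y₂ y₃)

module _ {n m} (S : Span n m) where

  left-injective : ∀ {a b} → left S a ≡ left S b → a ≡ b
  left-injective = monic⇒injective (apex S) (left S) (leftMonic S)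

  Rel-closed : TernClosed (Rel S)
  Rel-closed (a , refl , refl) (b , refl , refl) (c , refl , refl) =
    _×[_]_ (apex S) a b c , leftHom S a b c , rightHom S a b c

  Rel-functional : Functional (Rel S)
  Rel-functional (a , la≡x , ra≡y) (b , lb≡x , rb≡y′) =
    trans (sym ra≡y) (trans (cong (right S) (left-injective (trans la≡x (sym lb≡x)))) rb≡y′)

  Rel-decidable : Decidable₂ (Rel S)
  Rel-decidable x y =
    carrier-searchable (apex S) (left S) (leftHom S) left-injective
      (λ a → ≡-dec _≟_ (left S a) x ×-dec ≡-dec _≟_ (right S a) y)

  Rel-injective : (T : Span m n) → CompIsRestr S T → Functional (flip (Rel S))
  Rel-injective T S⨾T≈rS {y} {x} {x′} Sxy Sx′y =
    proj₁ (Equivalence.to (S⨾T≈rS x x′) (y , Sxy , T-inverse Sx′y))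
    where
    T-inverse : ∀ {x y} → Rel S x y → Rel T y x
    T-inverse {x} {y} Sxy with Equivalence.from (S⨾T≈rS x x) (refl , y , Sxy)
    ... | y₀ , Sxy₀ , Ty₀x = subst (λ z → Rel T z x) (Rel-functional Sxy₀ Sxy) Ty₀x

record AffineExtension {n m} (R : Z2^ n → Z2^ m → Set) : Set where
  field
    extension  : Affine m n
    extends    : ∀ {x y} → R x y → extension ⟨$⟩ x ≡ y
    into-range : ∀ x → ∃ λ x′ → R x′ (extension ⟨$⟩ x)

Slice : ∀ {n m} → Bool → (Z2^ (suc n) → Z2^ m → Set) → Z2^ n → Z2^ m → Set
Slice b R x y = R (b ∷ x) y

module _ {n m} {R : Z2^ (suc n) → Z2^ m → Set} where

  only-slice : ∀ b → ¬ ∃₂ (Slice (not b) R) → ∀ {c x y} → R (c ∷ x) y → c ≡ b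
  only-slice false _     {false} _ = refl
  only-slice true  _     {true}  _ = refl
  only-slice false empty {true}  r = ⊥-elim (empty (_ , _ , r))
  only-slice true  empty {false} r = ⊥-elim (empty (_ , _ , r))

  extend-by-zero-column : ∀ b → ¬ ∃₂ (Slice (not b) R) → AffineExtension (Slice b R) → AffineExtension R
  extend-by-zero-column b empty E = record
    { extension  = 0v ∷ h
    ; extends    = extends
    ; into-range = into-range
    }
    where
    open AffineExtension E renaming (extension to h; extends to h-extends; into-range to h-into-range)
    extends : ∀ {x y} → R x y → (0v ∷ h) ⟨$⟩ x ≡ y
    extends {c ∷ x} r =
      trans (⟨$⟩-zero-column h c x) (h-extends (subst (λ c → R (c ∷ x) _) (only-slice b empty r) r))
    into-range : ∀ x → ∃ λ x′ → R x′ ((0v ∷ h) ⟨$⟩ x)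
    into-range (c ∷ x) =
      let x′ , r = h-into-range x in b ∷ x′ , subst (R (b ∷ x′)) (sym (⟨$⟩-zero-column h c x)) r

  -- The column d makes the extension take the value q at true ∷ p; closing R under tern with
  -- that point carries the 0-slice onto the 1-slice and back.
  extend-across : TernClosed R → AffineExtension (Slice false R) →
                  ∀ {p q} → R (true ∷ p) q → AffineExtension R
  extend-across closed E {p} {q} Rpq = record
    { extension  = d ∷ h
    ; extends    = extends
    ; into-range = into-range
    }
    where
    open AffineExtension E renaming (extension to h; extends to h-extends; into-range to h-into-range)
    d = q ⊕ (h ⟨$⟩ p)
    p′ = proj₁ (h-into-range p)
    Rp′ : R (false ∷ p′) (h ⟨$⟩ p)
    Rp′ = proj₂ (h-into-range p)
    into-range : ∀ x → ∃ λ x′ → R x′ ((d ∷ h) ⟨$⟩ x)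
    into-range (false ∷ x) =
      let x′ , r = h-into-range x in false ∷ x′ , subst (R (false ∷ x′)) (sym (⊕.identityˡ _)) r
    into-range (true ∷ x) = let x′ , r = h-into-range x in _ , closed Rpq Rp′ r
    extends : ∀ {x y} → R x y → (d ∷ h) ⟨$⟩ x ≡ y
    extends {false ∷ x} r = trans (⊕.identityˡ _) (h-extends r)
    extends {true ∷ x} {y} r = begin
      (q ⊕ h ⟨$⟩ p) ⊕ h ⟨$⟩ x   ≡⟨ ⊕.assoc q _ _ ⟩
      q ⊕ (h ⟨$⟩ p ⊕ h ⟨$⟩ x)   ≡⟨ cong (q ⊕_) (⊕.∙-cancelʳ (h ⟨$⟩ p) _ _ across) ⟩
      q ⊕ (q ⊕ y)               ≡⟨ ⊕.\\-leftDividesʳ q y ⟩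
      y                         ∎
      where
      open ≡-Reasoning
      across : tern (h ⟨$⟩ p) (h ⟨$⟩ x) (h ⟨$⟩ p) ≡ tern q y (h ⟨$⟩ p)
      across = begin
        tern (h ⟨$⟩ p) (h ⟨$⟩ x) (h ⟨$⟩ p)   ≡⟨ cong (tern _ _) (sym (h-extends Rp′)) ⟩
        tern (h ⟨$⟩ p) (h ⟨$⟩ x) (h ⟨$⟩ p′)  ≡⟨ sym (⟨$⟩-tern h p x p′) ⟩
        h ⟨$⟩ tern p x p′                   ≡⟨ h-extends (closed Rpq r Rp′) ⟩
        tern q y (h ⟨$⟩ p)                   ∎

affine-extension : ∀ n {m} {R : Z2^ n → Z2^ m → Set} → Decidable₂ R → TernClosed R → Functional R →
                   ∃₂ R → AffineExtension R
affine-extension zero R? closed functional ([] , y , r) = record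
  { extension  = constant y
  ; extends    = λ { {[]} r′ → functional r r′ }
  ; into-range = λ { [] → [] , r }
  }
affine-extension (suc n) {R = R} R? closed functional (c ∷ x , y , r) =
  extend (∃₂? (R? ∘ (false ∷_))) (∃₂? (R? ∘ (true ∷_)))
  where
  on-slice : ∀ b → ∃₂ (Slice b R) → AffineExtension (Slice b R)
  on-slice false = affine-extension n (R? ∘ (false ∷_)) closed functional
  on-slice true  = affine-extension n (R? ∘ (true ∷_)) closed functional
  extend : Dec (∃₂ (Slice false R)) → Dec (∃₂ (Slice true R)) → AffineExtension R
  extend (yes inhabited₀) (yes (_ , _ , r₁)) = extend-across closed (on-slice false inhabited₀) r₁
  extend (yes inhabited₀) (no  empty₁)       =
    extend-by-zero-column false empty₁ (on-slice false inhabited₀)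
  extend (no  empty₀)     _                  =
    extend-by-zero-column true empty₀
      (on-slice true (x , y , subst (λ c → R (c ∷ x) y) (only-slice {R = R} true empty₀ r) r))

graph-by-retraction : ∀ {n m} {R : Z2^ n → Z2^ m → Set} (E : AffineExtension R) (k : Affine n m) →
                      (∀ {x y} → R x y → k ⟨$⟩ y ≡ x) →
                      let h = AffineExtension.extension E in
                      ∀ x y → R x y ⇔ (k ⟨$⟩ (h ⟨$⟩ x) ≡ x × h ⟨$⟩ x ≡ y)
graph-by-retraction {R = R} E k k-extends x y = mk⇔
  (λ r → trans (cong (k ⟨$⟩_) (extends r)) (k-extends r) , extends r)
  (λ (khx≡x , hx≡y) → let x′ , r = into-range x in
     subst₂ R (trans (sym (k-extends r)) khx≡x) hx≡y r)
  where open AffineExtension E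

record Runs {n m} (c : Circ n m) (x : Z2^ n) (y : Z2^ m) : Set where
  constructor runs
  field ⟦⟧≡just : ⟦ c ⟧ x ≡ just y
open Runs

module _ {a b c : ℕ} where

  ⨾-runs : ∀ {f : Circ a b} {g : Circ b c} {x y z} → Runs f x y → Runs g y z → Runs (f ⨾ g) x z
  ⨾-runs {g = g} (runs fx≡y) (runs gy≡z) = runs (trans (cong (_>>= ⟦ g ⟧) fx≡y) gy≡z)

  ⨾-runs-first : ∀ {f : Circ a b} (g : Circ b c) {x y} → Runs f x y → ⟦ f ⨾ g ⟧ x ≡ ⟦ g ⟧ y
  ⨾-runs-first g (runs fx≡y) = cong (_>>= ⟦ g ⟧) fx≡y

splitAt-++ : ∀ {A : Set} a {c} (xs : Vec A a) (ys : Vec A c) → splitAt a (xs ++ ys) ≡ (xs , ys , refl)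
splitAt-++ zero    []       ys = refl
splitAt-++ (suc a) (x ∷ xs) ys rewrite splitAt-++ a xs ys = refl

⟦⊗⟧-++ : ∀ {a b c d} (f : Circ a b) (g : Circ c d) xs ys →
         ⟦ f ⊗ g ⟧ (xs ++ ys) ≡ (⟦ f ⟧ xs >>= λ u → ⟦ g ⟧ ys >>= λ v → just (u ++ v))
⟦⊗⟧-++ {a} f g xs ys rewrite splitAt-++ a xs ys = refl

⊗-runs : ∀ {a b c d} {f : Circ a b} {g : Circ c d} {xs ys u v} →
         Runs f xs u → Runs g ys v → Runs (f ⊗ g) (xs ++ ys) (u ++ v)
⊗-runs {f = f} {g} {xs} {ys} {u} (runs fxs≡u) (runs gys≡v) = runs (begin
  ⟦ f ⊗ g ⟧ (xs ++ ys)                                       ≡⟨ ⟦⊗⟧-++ f g xs ys ⟩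
  (⟦ f ⟧ xs >>= λ u → ⟦ g ⟧ ys >>= λ v → just (u ++ v))     ≡⟨ cong (_>>= _) fxs≡u ⟩
  (⟦ g ⟧ ys >>= λ v → just (u ++ v))                         ≡⟨ cong (_>>= _) gys≡v ⟩
  just (u ++ _)                                              ∎)
  where open ≡-Reasoning

idc-runs : ∀ {n} {x : Z2^ n} → Runs (idc n) x x
idc-runs = runs refl

not-gate : Circ 1 1
not-gate = ((ket1 ⊗ idc 1) ⨾ cnot) ⨾ (bra1 ⊗ idc 1)

not-runs : ∀ b → Runs not-gate (b ∷ []) (not b ∷ [])
not-runs false = runs refl
not-runs true  = runs refl

ket0 : Circ 0 1
ket0 = ket1 ⨾ not-gate

bra0 : Circ 1 0
bra0 = not-gate ⨾ bra1

prepare-zeros : ∀ m → Circ 0 m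
prepare-zeros zero    = idc 0
prepare-zeros (suc m) = ket0 ⊗ prepare-zeros m

prepare-zeros-runs : ∀ m → Runs (prepare-zeros m) [] 0v
prepare-zeros-runs zero    = runs refl
prepare-zeros-runs (suc m) = ⊗-runs {xs = []} (runs refl) (prepare-zeros-runs m)

postselect-zeros : ∀ n → Circ n 0
postselect-zeros zero    = idc 0
postselect-zeros (suc n) = bra0 ⊗ postselect-zeros n

postselect-zeros-runs : ∀ n → Runs (postselect-zeros n) 0v []
postselect-zeros-runs zero    = runs refl
postselect-zeros-runs (suc n) = ⊗-runs {xs = false ∷ []} (runs refl) (postselect-zeros-runs n)

postselect-zeros⁻¹ : ∀ n z {w} → ⟦ postselect-zeros n ⟧ z ≡ just w → z ≡ 0v
postselect-zeros⁻¹ zero    []          _ = refl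
postselect-zeros⁻¹ (suc n) (true  ∷ z) ()
postselect-zeros⁻¹ (suc n) (false ∷ z) _ with ⟦ postselect-zeros n ⟧ z in eq
postselect-zeros⁻¹ (suc n) (false ∷ z) _  | just _  = cong (false ∷_) (postselect-zeros⁻¹ n z eq)
postselect-zeros⁻¹ (suc n) (false ∷ z) () | nothing

postselect-zeros-⊗ : ∀ n {m} (z : Z2^ n) (y y′ : Z2^ m) →
                     ⟦ postselect-zeros n ⊗ idc m ⟧ (z ++ y) ≡ just y′ ⇔ (z ≡ 0v × y ≡ y′)
postselect-zeros-⊗ n {m} z y y′ = mk⇔ to from
  where
  to : ⟦ postselect-zeros n ⊗ idc m ⟧ (z ++ y) ≡ just y′ → z ≡ 0v × y ≡ y′
  to eq with ⟦ postselect-zeros n ⟧ z in ps | trans (sym (⟦⊗⟧-++ (postselect-zeros n) (idc m) z y)) eq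
  ... | just [] | eq′ = postselect-zeros⁻¹ n z ps , just-injective eq′
  ... | nothing | ()
  from : z ≡ 0v × y ≡ y′ → ⟦ postselect-zeros n ⊗ idc m ⟧ (z ++ y) ≡ just y′
  from (refl , refl) = ⟦⟧≡just (⊗-runs (postselect-zeros-runs n) idc-runs)

unitorʳ⁻¹ : ∀ n → Circ n (n + 0)
unitorʳ⁻¹ zero    = idc 0
unitorʳ⁻¹ (suc n) = idc 1 ⊗ unitorʳ⁻¹ n

unitorʳ⁻¹-runs : ∀ n (x : Z2^ n) → Runs (unitorʳ⁻¹ n) x (x ++ [])
unitorʳ⁻¹-runs zero    []      = runs refl
unitorʳ⁻¹-runs (suc n) (b ∷ x) = ⊗-runs {xs = b ∷ []} idc-runs (unitorʳ⁻¹-runs n x)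

bubble : ∀ b a → Circ (suc (b + a)) (b + suc a)
bubble zero    a = idc (suc a)
bubble (suc b) a = (σ ⊗ idc (b + a)) ⨾ (idc 1 ⊗ bubble b a)

bubble-runs : ∀ b a w (v : Z2^ b) (u : Z2^ a) → Runs (bubble b a) (w ∷ v ++ u) (v ++ w ∷ u)
bubble-runs zero    a w []      u = runs refl
bubble-runs (suc b) a w (x ∷ v) u =
  ⨾-runs (⊗-runs {xs = w ∷ x ∷ []} (runs refl) idc-runs)
         (⊗-runs {xs = x ∷ []} idc-runs (bubble-runs b a w v u))

swap : ∀ a b → Circ (a + b) (b + a)
swap zero    b = unitorʳ⁻¹ b
swap (suc a) b = (idc 1 ⊗ swap a b) ⨾ bubble b a

swap-runs : ∀ a b (u : Z2^ a) (v : Z2^ b) → Runs (swap a b) (u ++ v) (v ++ u)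
swap-runs zero    b []      v = unitorʳ⁻¹-runs b v
swap-runs (suc a) b (w ∷ u) v =
  ⨾-runs (⊗-runs {xs = w ∷ []} idc-runs (swap-runs a b u v)) (bubble-runs b a w v u)

xor-constant : ∀ {k} → Z2^ k → Circ k k
xor-constant []          = idc 0
xor-constant (false ∷ c) = idc 1 ⊗ xor-constant c
xor-constant (true  ∷ c) = not-gate ⊗ xor-constant c

xor-constant-runs : ∀ {k} (c v : Z2^ k) → Runs (xor-constant c) v (c ⊕ v)
xor-constant-runs []          []      = runs refl
xor-constant-runs (false ∷ c) (b ∷ v) = ⊗-runs {xs = b ∷ []} idc-runs (xor-constant-runs c v)
xor-constant-runs (true  ∷ c) (b ∷ v) = ⊗-runs {xs = b ∷ []} (not-runs b) (xor-constant-runs c v)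

cnot-if : Bool → Circ 2 2
cnot-if false = idc 2
cnot-if true  = cnot

cnot-if-runs : ∀ b d v → Runs (cnot-if d) (b ∷ v ∷ []) (b ∷ ((b ∧ d) xor v) ∷ [])
cnot-if-runs false false _ = runs refl
cnot-if-runs false true  _ = runs refl
cnot-if-runs true  false _ = runs refl
cnot-if-runs true  true  _ = runs refl

skip : ∀ {k} → Circ (suc k) (suc k) → Circ (suc (suc k)) (suc (suc k))
skip {k} X = ((σ ⊗ idc k) ⨾ (idc 1 ⊗ X)) ⨾ (σ ⊗ idc k)

skip-runs : ∀ {k} {X : Circ (suc k) (suc k)} {b w r r′} → Runs X (b ∷ r) (b ∷ r′) →
            Runs (skip X) (b ∷ w ∷ r) (b ∷ w ∷ r′)
skip-runs {b = b} {w} X-runs =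
  ⨾-runs (⨾-runs (⊗-runs {xs = b ∷ w ∷ []} (runs refl) idc-runs) (⊗-runs {xs = w ∷ []} idc-runs X-runs))
         (⊗-runs {xs = w ∷ b ∷ []} (runs refl) idc-runs)

controlled-xor : ∀ {k} → Z2^ k → Circ (suc k) (suc k)
controlled-xor []      = idc 1
controlled-xor (d ∷ δ) = (cnot-if d ⊗ idc _) ⨾ skip (controlled-xor δ)

controlled-xor-runs : ∀ {k} (δ : Z2^ k) b v → Runs (controlled-xor δ) (b ∷ v) (b ∷ scale b δ ⊕ v)
controlled-xor-runs []      false [] = runs refl
controlled-xor-runs []      true  [] = runs refl
controlled-xor-runs (d ∷ δ) false (v₀ ∷ v) =
  ⨾-runs (⊗-runs {xs = false ∷ v₀ ∷ []} (cnot-if-runs false d v₀) idc-runs)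
         (skip-runs (controlled-xor-runs δ false v))
controlled-xor-runs (d ∷ δ) true  (v₀ ∷ v) =
  ⨾-runs (⊗-runs {xs = true ∷ v₀ ∷ []} (cnot-if-runs true d v₀) idc-runs)
         (skip-runs (controlled-xor-runs δ true v))

controlled-xor-after : ∀ a {k} → Z2^ k → Circ (suc (a + k)) (suc (a + k))
controlled-xor-after zero    δ = controlled-xor δ
controlled-xor-after (suc a) δ = skip (controlled-xor-after a δ)

controlled-xor-after-runs : ∀ a {k} (δ : Z2^ k) b (u : Z2^ a) v →
                            Runs (controlled-xor-after a δ) (b ∷ u ++ v) (b ∷ u ++ scale b δ ⊕ v)
controlled-xor-after-runs zero    δ b []      v = controlled-xor-runs δ b v
controlled-xor-after-runs (suc a) δ b (w ∷ u) v = skip-runs (controlled-xor-after-runs a δ b u v)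

xor-affine : ∀ {a k} → Affine k a → Circ (a + k) (a + k)
xor-affine (constant c)    = xor-constant c
xor-affine {suc a} (d ∷ f) = (idc 1 ⊗ xor-affine f) ⨾ controlled-xor-after a d

xor-affine-runs : ∀ {a k} (f : Affine k a) u v → Runs (xor-affine f) (u ++ v) (u ++ f ⟨$⟩ u ⊕ v)
xor-affine-runs (constant c)    []      v = xor-constant-runs c v
xor-affine-runs {suc a} (d ∷ f) (b ∷ u) v =
  subst (Runs (xor-affine (d ∷ f)) (b ∷ u ++ v))
        (cong (λ w → b ∷ u ++ w) (sym (⊕.assoc (scale b d) _ v)))
    (⨾-runs (⊗-runs {xs = b ∷ []} idc-runs (xor-affine-runs f u v))
            (controlled-xor-after-runs a d b u (f ⟨$⟩ u ⊕ v)))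

graph : ∀ {n m} → Affine m n → Circ n (n + m)
graph {n} {m} f = ((prepare-zeros m ⊗ idc n) ⨾ swap m n) ⨾ xor-affine f

graph-runs : ∀ {n m} (f : Affine m n) x → Runs (graph f) x (x ++ f ⟨$⟩ x)
graph-runs {n} {m} f x =
  subst (Runs (graph f) x) (cong (x ++_) (⊕.identityʳ (f ⟨$⟩ x)))
    (⨾-runs (⨾-runs (⊗-runs {xs = []} (prepare-zeros-runs m) idc-runs) (swap-runs m n 0v x))
            (xor-affine-runs f x 0v))

graph-defect : ∀ {n m} → Affine m n → Affine n m → Circ n (n + m)
graph-defect {n} {m} h k = (graph h ⨾ swap n m) ⨾ (xor-affine k ⨾ swap m n)

graph-defect-runs : ∀ {n m} (h : Affine m n) (k : Affine n m) x →
                    Runs (graph-defect h k) x ((k ⟨$⟩ (h ⟨$⟩ x) ⊕ x) ++ h ⟨$⟩ x)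
graph-defect-runs {n} {m} h k x =
  ⨾-runs (⨾-runs (graph-runs h x) (swap-runs n m x (h ⟨$⟩ x)))
         (⨾-runs (xor-affine-runs k (h ⟨$⟩ x) x) (swap-runs m n (h ⟨$⟩ x) _))

guarded : ∀ {n m} → Affine m n → Affine n m → Circ n m
guarded {n} {m} h k = graph-defect h k ⨾ (postselect-zeros n ⊗ idc m)

guarded-spec : ∀ {n m} (h : Affine m n) (k : Affine n m) x y →
               ⟦ guarded h k ⟧ x ≡ just y ⇔ (k ⟨$⟩ (h ⟨$⟩ x) ≡ x × h ⟨$⟩ x ≡ y)
guarded-spec {n} {m} h k x y
  rewrite ⨾-runs-first (postselect-zeros n ⊗ idc m) (graph-defect-runs h k x) =
  ⇔-trans (postselect-zeros-⊗ n (k ⟨$⟩ (h ⟨$⟩ x) ⊕ x) (h ⟨$⟩ x) y)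
          (mk⇔ (λ (≡0v , ≡y) → ⊕.x∙y⁻¹≈ε⇒x≈y _ _ ≡0v , ≡y) (λ (≡x , ≡y) → ⊕.x≈y⇒x∙y⁻¹≈ε ≡x , ≡y))

never : ∀ n m → Circ n m
never n m = ((ket0 ⨾ bra1) ⊗ idc n) ⨾ (postselect-zeros n ⨾ prepare-zeros m)

mainTheorem7 : ∀ (n m : ℕ) (S : Span n m) → IsPartialIso S →
                 Σ (Circ n m) λ c → Represents ⟦ c ⟧ S
-- T.
mainTheorem7 n m S (T , S⨾T≈rS , _) with ∃₂? (Rel-decidable S)
... | no ∄ = never n m , λ x y → mk⇔ (λ ()) (λ r → ⊥-elim (∄ (x , y , r)))
... | yes (x₀ , y₀ , r₀) = guarded h k , λ x y →
  ⇔-trans (guarded-spec h k x y)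
          (⇔-sym (graph-by-retraction forward k (AffineExtension.extends backward) x y))
  where
  forward = affine-extension n (Rel-decidable S) (Rel-closed S) (Rel-functional S) (x₀ , y₀ , r₀)
  backward = affine-extension m (flip (Rel-decidable S)) (λ r₁ r₂ r₃ → Rel-closed S r₁ r₂ r₃)
               (Rel-injective S T S⨾T≈rS) (y₀ , x₀ , r₀)
  h = AffineExtension.extension forward
  k = AffineExtension.extension backward
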